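{- Let $1\leq n\leq\omega$ and $3\leq s\leq\omega$, and let $\Gamma$ be a reduct of $(C_n^s,E)$. If $\mathrm{End}(\Gamma)=\overline{\mathrm{Aut}(C_n^s,E)}$, then $E$, $N$ and $Eq$ are preserved by all polymorphisms of $\Gamma$.
   Context: $(C_n^s,E)$ is the countable graph whose reflexive closure $Eq$ is an equivalence relation with $n$ classes each of size $s$; $N(x,y)$ means $\neg E(x,y)\wedge x\neq y$. A reduct is a structure on $C_n^s$ with relations first-order definable without parameters in $(C_n^s,E)$. $\mathrm{End}(\Gamma)$ is the set of endomorphisms of $\Gamma$; a polymorphism is a finitary operation preserving all relations of $\Gamma$; $\overline{F}$ denotes closure in the topology of pointwise convergence. -}

module Defs where

open import Data.Nat using (ℕ; zero; suc; _≤_)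
open import Data.Fin using (Fin)
open import Data.Product using (Σ; _×_; _,_; ∃)
open import Data.List using (List)
open import Data.Unit using (⊤)
open import Data.List.Membership.Propositional using (_∈_)
open import Relation.Binary.PropositionalEquality using (_≡_)
open import Relation.Nullary using (¬_)
open import Function.Bundles using (_⇔_)

data Card : Set where
  fin : ℕ → Card
  ω   : Card

El : Card → Set
El (fin k) = Fin k
El ω       = ℕ

_≤ᶜ_ : ℕ → Card → Set
m ≤ᶜ fin k = m ≤ k
m ≤ᶜ ω     = ⊤

-- The domain of C_n^s: pairs (class, position in class).
Dom : Card → Card → Set
Dom n s = El n × El s

module _ {n s : Card} where

  E : Dom n s → Dom n s → Set
  E (a , i) (b , j) = (a ≡ b) × ¬ (i ≡ j)

  N : Dom n s → Dom n s → Set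
  N x y = ¬ E x y × ¬ (x ≡ y)

  Eq : Dom n s → Dom n s → Set
  Eq x y = E x y Data.Sum.⊎ (x ≡ y)
    where import Data.Sum

data Formula : ℕ → Set where
  eqᶠ  : ∀ {k} → Fin k → Fin k → Formula k
  Eᶠ   : ∀ {k} → Fin k → Fin k → Formula k
  ¬ᶠ   : ∀ {k} → Formula k → Formula k
  _∧ᶠ_ : ∀ {k} → Formula k → Formula k → Formula k
  ∃ᶠ   : ∀ {k} → Formula (suc k) → Formula k

extend : ∀ {A : Set} {k} → A → (Fin k → A) → Fin (suc k) → A
extend a v Fin.zero    = a
extend a v (Fin.suc i) = v i

Sat : ∀ {n s k} → Formula k → (Fin k → Dom n s) → Set
Sat (eqᶠ i j)  v = v i ≡ v j
Sat (Eᶠ i j)   v = E (v i) (v j)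
Sat (¬ᶠ φ)     v = ¬ Sat φ v
Sat (φ ∧ᶠ ψ)   v = Sat φ v × Sat ψ v
Sat {n} {s} (∃ᶠ φ) v = Σ (Dom n s) (λ a → Sat φ (extend a v))

Rel : Card → Card → ℕ → Set₁
Rel n s k = (Fin k → Dom n s) → Set

Definable : ∀ {n s k} → Rel n s k → Set
Definable {n} {s} {k} R = Σ (Formula k) (λ φ → ∀ v → R v ⇔ Sat φ v)

record Reduct (n s : Card) : Set₁ where
  field
    Idx     : Set
    arity   : Idx → ℕ
    rel     : (i : Idx) → Rel n s (arity i)
    defin   : (i : Idx) → Definable (rel i)

Preserves : ∀ {n s m k} → ((Fin m → Dom n s) → Dom n s) → Rel n s k → Set
Preserves {m = m} {k} f R =
  (t : Fin m → Fin k → _) → (∀ j → R (t j)) → R (λ i → f (λ j → t j i))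

bin : ∀ {n s} → (Dom n s → Dom n s → Set) → Rel n s 2
bin R v = R (v Fin.zero) (v (Fin.suc Fin.zero))

IsPolymorphism : ∀ {n s} (Γ : Reduct n s) (m : ℕ) → ((Fin m → Dom n s) → Dom n s) → Set
IsPolymorphism Γ m f = ∀ i → Preserves f (Reduct.rel Γ i)

IsEndomorphism : ∀ {n s} (Γ : Reduct n s) → (Dom n s → Dom n s) → Set
IsEndomorphism Γ g = IsPolymorphism Γ 1 (λ v → g (v Fin.zero))

IsAut : ∀ {n s} → (Dom n s → Dom n s) → Set
IsAut {n} {s} g = Σ (Dom n s → Dom n s) (λ h →
  (∀ x → h (g x) ≡ x) × (∀ x → g (h x) ≡ x) × (∀ x y → E x y ⇔ E (g x) (g y)))

-- g lies in the closure of Aut(C_n^s,E) in the topology of pointwise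
-- convergence: every finite subset agrees with some automorphism.
InClosureAut : ∀ {n s} → (Dom n s → Dom n s) → Set
InClosureAut {n} {s} g = (A : List (Dom n s)) →
  Σ (Dom n s → Dom n s) (λ α → IsAut α × (∀ x → x ∈ A → α x ≡ g x))

-- For automorphisms α_j of (C_n^s, E), the map x ↦ f(α_1 x, …, α_m x) is an endomorphism of Γ,
-- hence by hypothesis locally an automorphism, and so preserves E and N.  Since Aut(C_n^s, E) is
-- transitive on E-edges and on N-edges, any m-tuple of E-edges (N-edges) is the image of one fixed
-- edge under such α_j, so f maps it to an E-edge (N-edge).  For s ≥ 3, Eq is the composite E ∘ E,
-- which is preserved because E is.
module Submission where

open import Defs
open import Data.Nat using (ℕ; zero; suc; s≤s)
open import Data.Fin using (Fin)
open import Data.Fin.Patterns using (0F; 1F; 2F)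
open import Data.Product using (Σ; ∃; _×_; _,_; proj₁; proj₂)
open import Data.Sum using (inj₁; inj₂)
open import Data.Empty using (⊥-elim)
open import Data.List using ([]; _∷_)
open import Data.List.Relation.Unary.Any using (here; there)
open import Function.Base using (_∘_)
open import Function.Bundles using (_⇔_; mk⇔; Equivalence; _↔_; Inverse; mk↔ₛ′; Injection)
open import Function.Properties.Inverse using (↔-refl; ↔-trans; ↔⇒↣)
open import Relation.Nullary using (¬_; yes; no)
open import Relation.Binary.Definitions using (DecidableEquality; Irreflexive)
open import Relation.Binary.Construct.Composition using (_;_)
open import Relation.Binary.PropositionalEquality
  using (_≡_; _≢_; refl; sym; trans; cong; cong₂; subst₂; ≢-sym)
import Data.Fin.Properties as Fin
import Data.Nat.Properties as ℕ
import Data.Product.Properties as Product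

module WithDecidableEquality {A : Set} (_≟_ : DecidableEquality A) where

  override : {B : Set} → A → B → A → B → (A → B) → A → B
  override u bu v bv b x with x ≟ u
  ... | yes _ = bu
  ... | no _ with x ≟ v
  ...   | yes _ = bv
  ...   | no _ = b x

  module _ {B : Set} {u v : A} {bu bv : B} {b : A → B} where

    override-fst : override u bu v bv b u ≡ bu
    override-fst with u ≟ u
    ... | yes _ = refl
    ... | no u≢u = ⊥-elim (u≢u refl)

    override-snd : u ≢ v → override u bu v bv b v ≡ bv
    override-snd u≢v with v ≟ u
    ... | yes v≡u = ⊥-elim (u≢v (sym v≡u))
    ... | no _ with v ≟ v
    ...   | yes _ = refl
    ...   | no v≢v = ⊥-elim (v≢v refl)

    override-elim : (P : A → B → Set) → P u bu → P v bv → (∀ x → x ≢ u → x ≢ v → P x (b x))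
                  → ∀ x → P x (override u bu v bv b x)
    override-elim P Pu Pv Pb x with x ≟ u
    ... | yes refl = Pu
    ... | no x≢u with x ≟ v
    ...   | yes refl = Pv
    ...   | no x≢v = Pb x x≢u x≢v

    override-other : ∀ {x} → x ≢ u → x ≢ v → override u bu v bv b x ≡ b x
    override-other {x} = override-elim (λ x′ y → x′ ≢ u → x′ ≢ v → y ≡ b x′)
      (λ u≢u _ → ⊥-elim (u≢u refl)) (λ _ v≢v → ⊥-elim (v≢v refl)) (λ _ _ _ _ _ → refl) x

  swap : A → A → A → A
  swap p q = override p q q p (λ x → x)

  swap-fst : ∀ p q → swap p q p ≡ q
  swap-fst p q = override-fst

  swap-snd : ∀ p q → swap p q q ≡ p
  swap-snd p q with p ≟ q
  ... | yes refl = override-fst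
  ... | no p≢q = override-snd p≢q

  swap-involutive : ∀ p q x → swap p q (swap p q x) ≡ x
  swap-involutive p q = override-elim (λ x y → swap p q y ≡ x) (swap-snd p q) override-fst
    (λ _ → override-other)

  transposition : A → A → A ↔ A
  transposition p q = mk↔ₛ′ (swap p q) (swap p q) (swap-involutive p q) (swap-involutive p q)

  sendPair : ∀ {p q p′ q′} → p ≢ q → p′ ≢ q′ → ∃ λ (π : A ↔ A) → Inverse.to π p ≡ p′ × Inverse.to π q ≡ q′
  sendPair {p} {q} {p′} {q′} p≢q p′≢q′ = π , trans (cong (swap p p′) fixes-p) (swap-fst p p′)
                                          , trans (cong (swap p p′) (swap-fst q q″)) (swap-involutive p p′ q′)
    where
    q″ : A
    q″ = swap p p′ q′
    p≢q″ : p ≢ q″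
    p≢q″ p≡q″ = p′≢q′ (trans (sym (swap-fst p p′)) (trans (cong (swap p p′) p≡q″) (swap-involutive p p′ q′)))
    fixes-p : swap q q″ p ≡ p
    fixes-p = override-other p≢q p≢q″
    π : A ↔ A
    π = ↔-trans (transposition q q″) (transposition p p′)

  avoid-two : ∀ {a b c} → a ≢ b → a ≢ c → b ≢ c → ∀ x y → ∃ λ z → z ≢ x × z ≢ y
  avoid-two {a} {b} {c} a≢b a≢c b≢c x y with a ≟ x | a ≟ y
  ... | no a≢x | no a≢y = a , a≢x , a≢y
  ... | yes refl | _ with b ≟ y
  ...   | yes refl = c , ≢-sym a≢c , ≢-sym b≢c
  ...   | no b≢y = b , ≢-sym a≢b , b≢y
  avoid-two {a} {b} {c} a≢b a≢c b≢c x y | no a≢x | yes refl with b ≟ x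
  ...   | yes refl = c , ≢-sym b≢c , ≢-sym a≢c
  ...   | no b≢x = b , b≢x , ≢-sym a≢b

El-≟ : (c : Card) → DecidableEquality (El c)
El-≟ (fin _) = Fin._≟_
El-≟ ω       = ℕ._≟_

distinct-triple : (s : Card) → 3 ≤ᶜ s
                → Σ (El s) λ a → Σ (El s) λ b → Σ (El s) λ c → a ≢ b × a ≢ c × b ≢ c
distinct-triple (fin 1) (s≤s ())
distinct-triple (fin 2) (s≤s (s≤s ()))
distinct-triple (fin (suc (suc (suc _)))) _ = 0F , 1F , 2F , (λ ()) , (λ ()) , (λ ())
distinct-triple ω _ = 0 , 1 , 2 , (λ ()) , (λ ()) , (λ ())

inhabitant : (n : Card) → 1 ≤ᶜ n → El n
inhabitant (fin (suc _)) _ = 0F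
inhabitant ω _ = 0

module _ {n s : Card} where

  private
    module Classes   = WithDecidableEquality (El-≟ n)
    module Positions = WithDecidableEquality (El-≟ s)

  AutInvariant : (Dom n s → Dom n s → Set) → Set
  AutInvariant R = ∀ {β} → IsAut {n} {s} β → ∀ {x y} → R x y → R (β x) (β y)

  AutTransitiveOn : (Dom n s → Dom n s → Set) → Set
  AutTransitiveOn R = ∀ {a b a′ b′} → R a b → R a′ b′ → ∃ λ β → IsAut {n} {s} β × β a ≡ a′ × β b ≡ b′

  E-irreflexive : Irreflexive _≡_ (E {n} {s})
  E-irreflexive refl (_ , i≢i) = i≢i refl

  N-irreflexive : Irreflexive _≡_ (N {n} {s})
  N-irreflexive refl (_ , x≢x) = x≢x refl

  N⇒different-classes : ∀ {c d i j} → N {n} {s} (c , i) (d , j) → c ≢ d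
  N⇒different-classes {i = i} {j} (¬E , x≢y) refl with El-≟ s i j
  ... | yes refl = x≢y refl
  ... | no i≢j = ¬E (refl , i≢j)

  IsAut-resp-≗ : ∀ {β γ : Dom n s → Dom n s} → IsAut β → (∀ x → γ x ≡ β x) → IsAut γ
  IsAut-resp-≗ (h , hβ , βh , β⇔) γ≗β =
    h , (λ x → trans (cong h (γ≗β x)) (hβ x)) , (λ x → trans (γ≗β (h x)) (βh x)) ,
    (λ x y → mk⇔ (subst₂ E (sym (γ≗β x)) (sym (γ≗β y)) ∘ Equivalence.to (β⇔ x y))
                 (Equivalence.from (β⇔ x y) ∘ subst₂ E (γ≗β x) (γ≗β y)))

  E-autInvariant : AutInvariant E
  E-autInvariant (_ , _ , _ , β⇔) {x} {y} = Equivalence.to (β⇔ x y)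

  N-autInvariant : AutInvariant N
  N-autInvariant (h , hβ , _ , β⇔) {x} {y} (¬E , x≢y) =
    ¬E ∘ Equivalence.from (β⇔ x y) ,
    λ βx≡βy → x≢y (trans (sym (hβ x)) (trans (cong h βx≡βy) (hβ y)))

  InClosureAut-preserves : ∀ {R g} → AutInvariant R → InClosureAut g → ∀ {x y} → R x y → R (g x) (g y)
  InClosureAut-preserves {R} inv g∈cl {x} {y} Rxy with g∈cl (x ∷ y ∷ [])
  ... | β , β-aut , β≡g = subst₂ R (β≡g x (here refl)) (β≡g y (there (here refl))) (inv β-aut Rxy)

  wreath : El n ↔ El n → (El n → El s ↔ El s) → Dom n s → Dom n s
  wreath σ ρ (c , i) = Inverse.to σ c , Inverse.to (ρ c) i

  wreath-isAut : ∀ σ ρ → IsAut (wreath σ ρ)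
  wreath-isAut σ ρ = unwreath , unwreath∘wreath , wreath∘unwreath , wreath-preserves-E
    where
    open Inverse
    to-injective : ∀ {A : Set} (π : A ↔ A) {x y} → to π x ≡ to π y → x ≡ y
    to-injective π = Injection.injective (↔⇒↣ π)
    unwreath : Dom n s → Dom n s
    unwreath (d , j) = from σ d , from (ρ (from σ d)) j
    unwreath∘wreath : ∀ x → unwreath (wreath σ ρ x) ≡ x
    unwreath∘wreath (c , i) rewrite strictlyInverseʳ σ c = cong (c ,_) (strictlyInverseʳ (ρ c) i)
    wreath∘unwreath : ∀ x → wreath σ ρ (unwreath x) ≡ x
    wreath∘unwreath (d , j) = cong₂ _,_ (strictlyInverseˡ σ d) (strictlyInverseˡ (ρ (from σ d)) j)
    wreath-preserves-E : ∀ x y → E x y ⇔ E (wreath σ ρ x) (wreath σ ρ y)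
    wreath-preserves-E (c , i) (d , j) = mk⇔ forth back
      where
      forth : E (c , i) (d , j) → E (wreath σ ρ (c , i)) (wreath σ ρ (d , j))
      forth (refl , i≢j) = refl , i≢j ∘ to-injective (ρ c)
      back : E (wreath σ ρ (c , i)) (wreath σ ρ (d , j)) → E (c , i) (d , j)
      back (σc≡σd , ρi≢ρj) with to-injective σ σc≡σd
      ... | refl = refl , ρi≢ρj ∘ cong (to (ρ c))

  E-autTransitive : AutTransitiveOn E
  E-autTransitive {c , i} {_ , j} {c′ , i′} {_ , j′} (refl , i≢j) (refl , i′≢j′)
    with Positions.sendPair i≢j i′≢j′
  ... | π , πi≡i′ , πj≡j′ =
    wreath σ (λ _ → π) , wreath-isAut σ (λ _ → π) ,
    cong₂ _,_ (Classes.swap-fst c c′) πi≡i′ , cong₂ _,_ (Classes.swap-fst c c′) πj≡j′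
    where
    σ : El n ↔ El n
    σ = Classes.transposition c c′

  N-autTransitive : AutTransitiveOn N
  N-autTransitive {c , i} {d , j} {_ , i′} {_ , j′} Nab Na′b′
    with Classes.sendPair (N⇒different-classes Nab) (N⇒different-classes Na′b′)
  ... | σ , σc≡c′ , σd≡d′ =
    wreath σ ρ , wreath-isAut σ ρ ,
    cong₂ _,_ σc≡c′ (trans (cong (λ π → Inverse.to π i) ρc) (Positions.swap-fst i i′)) ,
    cong₂ _,_ σd≡d′ (trans (cong (λ π → Inverse.to π j) ρd) (Positions.swap-fst j j′))
    where
    ρ : El n → El s ↔ El s
    ρ = Classes.override c (Positions.transposition i i′) d (Positions.transposition j j′) (λ _ → ↔-refl)
    ρc : ρ c ≡ Positions.transposition i i′
    ρc = Classes.override-fst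
    ρd : ρ d ≡ Positions.transposition j j′
    ρd = Classes.override-snd (N⇒different-classes Nab)

  E∘E⇒Eq : ∀ {x y} → (E ; E) x y → Eq {n} {s} x y
  E∘E⇒Eq {_ , i} {_ , j} (_ , (refl , _) , (refl , _)) with El-≟ s i j
  ... | yes refl = inj₂ refl
  ... | no i≢j = inj₁ (refl , i≢j)

  Eq⇒E∘E : ∀ {a b c : El s} → a ≢ b → a ≢ c → b ≢ c → ∀ {x y} → Eq {n} {s} x y → (E ; E) x y
  Eq⇒E∘E a≢b a≢c b≢c {c , i} {d , j} Eqxy with Positions.avoid-two a≢b a≢c b≢c i j
  ... | k , k≢i , k≢j = (c , k) , (refl , ≢-sym k≢i) , (same-class Eqxy , k≢j)
    where
    same-class : Eq {n} {s} (c , i) (d , j) → c ≡ d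
    same-class (inj₁ (c≡d , _)) = c≡d
    same-class (inj₂ refl) = refl

Preserves-; : ∀ {n s m} {f : (Fin m → Dom n s) → Dom n s} {R S : Dom n s → Dom n s → Set}
            → Preserves f (bin R) → Preserves f (bin S) → Preserves f (bin (R ; S))
Preserves-; {f = f} f-R f-S t R;S-t =
  f middle , f-R (λ j → λ { 0F → t j 0F ; 1F → middle j }) (λ j → proj₁ (proj₂ (R;S-t j)))
           , f-S (λ j → λ { 0F → middle j ; 1F → t j 1F }) (λ j → proj₂ (proj₂ (R;S-t j)))
  where
  middle : Fin _ → Dom _ _
  middle j = proj₁ (R;S-t j)

-- A nullary polymorphism would be a constant endomorphism, and constants do not preserve E.
nullary-¬Preserves-E : ∀ {n s} (f : (Fin 0 → Dom n s) → Dom n s) → ¬ Preserves f (bin E)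
nullary-¬Preserves-E f f-E = E-irreflexive refl (f-E (λ j _ → no-column j) (λ ()))
  where
  no-column : Fin 0 → Dom _ _
  no-column ()

module _ {n s : Card} (Γ : Reduct n s) (End≡closure : ∀ g → IsEndomorphism Γ g ⇔ InClosureAut g) where

  private
    module Points = WithDecidableEquality (Product.≡-dec (El-≟ n) (El-≟ s))

  IsAut⇒IsEndomorphism : ∀ {α} → IsAut α → IsEndomorphism Γ α
  IsAut⇒IsEndomorphism {α} α-aut = Equivalence.from (End≡closure α) (λ _ → α , α-aut , λ _ _ → refl)

  polymorphism∘automorphisms-isEndomorphism : ∀ {m f} → IsPolymorphism Γ m f
    → (α : Fin m → Dom n s → Dom n s) → (∀ j → IsAut (α j)) → IsEndomorphism Γ (λ x → f (λ j → α j x))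
  polymorphism∘automorphisms-isEndomorphism f-pol α α-aut i t Rt =
    f-pol i (λ j k → α j (t 0F k)) (λ j → IsAut⇒IsEndomorphism (α-aut j) i (λ _ → t 0F) (λ _ → Rt 0F))

  polymorphism-preserves : ∀ {m f} → IsPolymorphism Γ m f → ∀ {R u v}
    → AutInvariant R → AutTransitiveOn R → Irreflexive _≡_ R → R u v → Preserves f (bin R)
  polymorphism-preserves {m} {f} f-pol {R} {u} {v} R-inv R-trans R-irrefl Ruv t Rt =
    subst₂ R (cong f Points.override-fst) (cong f (Points.override-snd (λ u≡v → R-irrefl u≡v Ruv)))
      (InClosureAut-preserves R-inv (Equivalence.to (End≡closure g) g-endo) Ruv)
    where
    β : Fin m → Dom n s → Dom n s
    β j = proj₁ (R-trans Ruv (Rt j))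
    β-aut : ∀ j → IsAut (β j)
    β-aut j = proj₁ (proj₂ (R-trans Ruv (Rt j)))
    β-u : ∀ j → β j u ≡ t j 0F
    β-u j = proj₁ (proj₂ (proj₂ (R-trans Ruv (Rt j))))
    β-v : ∀ j → β j v ≡ t j 1F
    β-v j = proj₂ (proj₂ (proj₂ (R-trans Ruv (Rt j))))
    βs : Dom n s → Fin m → Dom n s
    βs x j = β j x
    -- Agrees with βs pointwise, but at u and v it is literally the columns of t, so that g u and g v
    -- are f applied to those columns without appeal to function extensionality.
    columns : Dom n s → Fin m → Dom n s
    columns = Points.override u (λ j → t j 0F) v (λ j → t j 1F) βs
    columns≗β : ∀ j x → columns x j ≡ β j x
    columns≗β j = Points.override-elim {bu = λ j → t j 0F} {bv = λ j → t j 1F} {b = βs}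
      (λ x c → c j ≡ β j x) (sym (β-u j)) (sym (β-v j)) (λ _ _ _ → refl)
    g : Dom n s → Dom n s
    g x = f (columns x)
    g-endo : IsEndomorphism Γ g
    g-endo = polymorphism∘automorphisms-isEndomorphism {f = f} f-pol (λ j x → columns x j)
      (λ j → IsAut-resp-≗ (β-aut j) (columns≗β j))

  polymorphism-preserves-N : ∀ {m f} → IsPolymorphism Γ m f → Preserves f (bin E) → Preserves f (bin N)
  polymorphism-preserves-N {zero} {f} _ f-E = ⊥-elim (nullary-¬Preserves-E f f-E)
  polymorphism-preserves-N {suc _} {f} f-pol _ t Nt =
    polymorphism-preserves {f = f} f-pol N-autInvariant N-autTransitive N-irreflexive (Nt 0F) t Nt

proposition6p2 : (n s : Card) → 1 ≤ᶜ n → 3 ≤ᶜ s → (Γ : Reduct n s)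
    → (∀ g → IsEndomorphism Γ g ⇔ InClosureAut g)
    → (m : ℕ) (f : (Fin m → Dom n s) → Dom n s) → IsPolymorphism Γ m f
    → Preserves f (bin E) × Preserves f (bin N) × Preserves f (bin Eq)
proposition6p2 n s 1≤n 3≤s Γ End≡closure m f f-pol with distinct-triple s 3≤s
... | a , b , c , a≢b , a≢c , b≢c = f-E , f-N , f-Eq
  where
  some-edge : E {n} {s} (inhabitant n 1≤n , a) (inhabitant n 1≤n , b)
  some-edge = refl , a≢b
  f-E : Preserves f (bin E)
  f-E = polymorphism-preserves Γ End≡closure {f = f} f-pol E-autInvariant E-autTransitive E-irreflexive some-edge
  f-N : Preserves f (bin N)
  f-N = polymorphism-preserves-N Γ End≡closure {f = f} f-pol f-E
  f-Eq : Preserves f (bin Eq)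
  f-Eq t Eq-t = E∘E⇒Eq (Preserves-; {f = f} {R = E} {S = E} f-E f-E t (λ j → Eq⇒E∘E a≢b a≢c b≢c (Eq-t j)))
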